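{- For integers $i\ge0$, $j\ge0$ and real $k$: (a) $\sum_{r=j}^{i}\binom{i}{r}(k)_{i-r}\,c_{r,j,k}=s_{i,j}$; (b) $\sum_{r=j}^{i}(i)_{i-r}\,(-1)^{i-r}\,c_{r,j,k}=c_{i,j,k+1}$, where $(i)_{i-r}=i!/r!$.
   Context: $(x)_n=x(x-1)\cdots(x-n+1)$ is the falling factorial ($(x)_0=1$). The signed Stirling numbers of the first kind $s_{i,r}$ are defined by $(x)_i=\sum_{r=0}^{i}s_{i,r}x^r$ (and $s_{i,j}=0$ for $j>i$). For integers $i,j\ge0$ and real $k$, $c_{i,j,k}=\sum_{r=j}^{i}\binom{r}{j}(-k)^{r-j}s_{i,r}$ (zero if $j>i$). -}

module Defs where

open import Level using (Level)
open import Data.Nat as ℕ using (ℕ; zero; suc; _∸_)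
open import Data.Integer as ℤ using (ℤ; +_; -[1+_])
open import Data.List using (List; []; _∷_)
open import Data.Nat.Combinatorics using (_C_; _P_)
open import Algebra.Bundles using (CommutativeRing)

-- Integer polynomials as coefficient lists (constant term first).

Poly : Set
Poly = List ℤ

shiftP : Poly → Poly
shiftP p = + 0 ∷ p

scaleP : ℤ → Poly → Poly
scaleP a []       = []
scaleP a (b ∷ p)  = (a ℤ.* b) ∷ scaleP a p

addP : Poly → Poly → Poly
addP []      q       = q
addP (a ∷ p) []      = a ∷ p
addP (a ∷ p) (b ∷ q) = (a ℤ.+ b) ∷ addP p q

mulLin : ℕ → Poly → Poly
mulLin m p = addP (shiftP p) (scaleP (ℤ.- (+ m)) p)

coeff : Poly → ℕ → ℤ
coeff []      _       = + 0
coeff (a ∷ p) zero    = a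
coeff (a ∷ p) (suc r) = coeff p r

fallingPoly : ℕ → Poly
fallingPoly zero    = + 1 ∷ []
fallingPoly (suc i) = mulLin i (fallingPoly i)

-- signed Stirling numbers of the first kind: (x)_i = Σ_r s i r x^r
-- (automatically 0 for r > i)
s : ℕ → ℕ → ℤ
s i r = coeff (fallingPoly i) r

-- Definitions over an arbitrary commutative ring R (the paper: R = ℝ)

module _ {c ℓ : Level} (R : CommutativeRing c ℓ) where
  open CommutativeRing R

  fromℕ : ℕ → Carrier
  fromℕ zero    = 0#
  fromℕ (suc n) = 1# + fromℕ n

  fromℤ : ℤ → Carrier
  fromℤ (+ n)      = fromℕ n
  fromℤ -[1+ n ]   = - fromℕ (suc n)

  _^_ : Carrier → ℕ → Carrier
  x ^ zero  = 1#
  x ^ suc n = x * (x ^ n)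

  falling : Carrier → ℕ → Carrier
  falling k zero    = 1#
  falling k (suc n) = falling k n * (k - fromℕ n)

  sumFrom : ℕ → ℕ → (ℕ → Carrier) → Carrier
  sumFrom a zero    f = 0#
  sumFrom a (suc n) f = f a + sumFrom (suc a) n f

  -- Σ_{r=a}^{b} f r  (empty, i.e. 0, when a > b)
  sumRange : ℕ → ℕ → (ℕ → Carrier) → Carrier
  sumRange a b f = sumFrom a (suc b ∸ a) f

  cc : ℕ → ℕ → Carrier → Carrier
  cc i j k = sumRange j i (λ r → fromℕ (r C j) * ((- k) ^ (r ∸ j)) * fromℤ (s i r))

module Submission where

-- The s i j are the coefficients of (x)_i, and c_{i,j,k} is the j-th coefficient of (x)_i after the
-- substitution x ↦ x - k, i.e. of (x - k)_i = (x - k)(x - k - 1)...(x - k - i + 1).  Both identities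
-- therefore compare coefficients in the Vandermonde convolution
--   (x - b)_i = Σ_r binom(i,r) (a - b)_{i-r} (x - a)_r,
-- which follows from (x - b)_{i+1} = (x - b - i)(x - b)_i and Pascal's rule: (a) is the case b = 0, a = k,
-- and (b) the case b = k + 1, a = k, using (-1)_m = (-1)^m m! and (i)_{i-r} = binom(i,r) (i-r)!.

open import Defs
open import Level using (Level)
open import Data.Nat using (ℕ; _∸_)
open import Data.Product using (_×_; _,_)
open import Data.Nat.Combinatorics using (_C_; _P_)
open import Algebra.Bundles using (CommutativeRing)

open import Algebra.Solver.Ring.AlmostCommutativeRing as ACR using (_-Raw-AlmostCommutative⟶_)
open import Data.Bool using (true)
open import Data.Fin using (toℕ)
open import Data.Fin.Properties using (toℕ<n)
open import Data.Integer as ℤ using (+_; -[1+_]; _⊖_)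
import Data.Integer.Properties as ℤ
open import Data.List using ([]; _∷_)
import Data.Maybe as Maybe
open import Data.Nat as ℕ using (zero; suc; _≤_; _<_; _≤ᵇ_; _!; s≤s)
import Data.Nat.Properties as ℕ
open import Data.Nat.Combinatorics using (nCk≡nPk/k!; nCk≡nC[n∸k]; k>n⇒nCk≡0; nCk+nC[k+1]≡[n+1]C[k+1])
open import Data.Nat.Combinatorics.Base using (_P′_)
open import Data.Nat.Combinatorics.Specification using (k!∣nP′k)
open import Data.Nat.Divisibility using (_∣_)
open import Data.Nat.DivMod using (_/_; m/n*n≡m)
open import Data.Sum using (_⊎_; inj₁; inj₂)
open import Relation.Binary.PropositionalEquality as ≡ using (_≡_)
open import Relation.Nullary.Decidable using (dec⇒maybe)

nPk≡nCk*k! : ∀ {n k} → k ≤ n → n P k ≡ (n C k) ℕ.* k !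
nPk≡nCk*k! {n} {k} k≤n = ≡.sym (begin
  (n C k) ℕ.* k !         ≡⟨ ≡.cong (ℕ._* k !) (nCk≡nPk/k! k≤n) ⟩
  ((n P k) / k !) ℕ.* k ! ≡⟨ m/n*n≡m k!∣nPk ⟩
  n P k                   ∎)
  where
  open ≡.≡-Reasoning
  instance _ = k ℕ.!≢0
  nPk≡nP′k : n P k ≡ n P′ k
  nPk≡nP′k with k ≤ᵇ n | ℕ.≤⇒≤ᵇ k≤n
  ... | true | _ = ≡.refl
  k!∣nPk : k ! ∣ n P k
  k!∣nPk = ≡.subst (k ! ∣_) (≡.sym nPk≡nP′k) (k!∣nP′k k≤n)

coeff-addP : ∀ p q r → coeff (addP p q) r ≡ coeff p r ℤ.+ coeff q r
coeff-addP []      q       r       = ≡.sym (ℤ.+-identityˡ _)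
coeff-addP (a ∷ p) []      r       = ≡.sym (ℤ.+-identityʳ _)
coeff-addP (a ∷ p) (b ∷ q) zero    = ≡.refl
coeff-addP (a ∷ p) (b ∷ q) (suc r) = coeff-addP p q r

coeff-scaleP : ∀ a p r → coeff (scaleP a p) r ≡ a ℤ.* coeff p r
coeff-scaleP a []      r       = ≡.sym (ℤ.*-zeroʳ a)
coeff-scaleP a (b ∷ p) zero    = ≡.refl
coeff-scaleP a (b ∷ p) (suc r) = coeff-scaleP a p r

module FallingFactorialCoefficients {c ℓ : Level} (R : CommutativeRing c ℓ) where
  open CommutativeRing R hiding (zero)
  open import Algebra.Properties.Ring ring
    using (-‿involutive; -0#≈0#; -‿distribˡ-*; -‿distribʳ-*; -1*x≈-x)
  open import Algebra.Properties.AbelianGroup +-abelianGroup using (⁻¹-∙-comm; xyx⁻¹≈y; ⁻¹-anti-homo-∙)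
  open import Algebra.Properties.CommutativeSemigroup +-commutativeSemigroup using ()
    renaming (x∙yz≈y∙xz to x+[y+z]≈y+[x+z])
  open import Algebra.Properties.CommutativeSemigroup *-commutativeSemigroup using ()
    renaming (x∙yz≈y∙xz to x*[y*z]≈y*[x*z])
  open import Algebra.Properties.Semiring.Mult semiring using (×-homo-+; ×1-homo-*) renaming (_×_ to _×′_)
  open import Algebra.Properties.Semiring.Sum semiring
    using (sum; ∑-distrib-+; *-distribˡ-sum; sum-cong-≋; sum-replicate-zero)
  open import Relation.Binary.Reasoning.Setoid setoid

  fromℕ≡×1 : ∀ n → fromℕ R n ≡ n ×′ 1#
  fromℕ≡×1 zero    = ≡.refl
  fromℕ≡×1 (suc n) = ≡.cong (_+_ 1#) (fromℕ≡×1 n)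

  fromℕ-+ : ∀ m n → fromℕ R (m ℕ.+ n) ≈ fromℕ R m + fromℕ R n
  fromℕ-+ m n rewrite fromℕ≡×1 (m ℕ.+ n) | fromℕ≡×1 m | fromℕ≡×1 n = ×-homo-+ 1# m n

  fromℕ-* : ∀ m n → fromℕ R (m ℕ.* n) ≈ fromℕ R m * fromℕ R n
  fromℕ-* m n rewrite fromℕ≡×1 (m ℕ.* n) | fromℕ≡×1 m | fromℕ≡×1 n = ×1-homo-* m n

  fromℤ-neg : ∀ a → fromℤ R (ℤ.- a) ≈ - fromℤ R a
  fromℤ-neg (+ zero)  = sym -0#≈0#
  fromℤ-neg (+ suc n) = refl
  fromℤ-neg -[1+ n ]  = sym (-‿involutive _)

  fromℤ-⊖ : ∀ m n → fromℤ R (m ⊖ n) ≈ fromℕ R m - fromℕ R n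
  fromℤ-⊖ m       zero    = sym (trans (+-congˡ -0#≈0#) (+-identityʳ _))
  fromℤ-⊖ zero    (suc n) = sym (+-identityˡ _)
  fromℤ-⊖ (suc m) (suc n) = begin
    fromℤ R (suc m ⊖ suc n)                      ≡⟨ ≡.cong (fromℤ R) (ℤ.[1+m]⊖[1+n]≡m⊖n m n) ⟩
    fromℤ R (m ⊖ n)                              ≈⟨ fromℤ-⊖ m n ⟩
    fromℕ R m - fromℕ R n                        ≈⟨ xyx⁻¹≈y 1# _ ⟨
    1# + (fromℕ R m - fromℕ R n) - 1#            ≈⟨ +-congʳ (+-assoc 1# _ _) ⟨
    1# + fromℕ R m - fromℕ R n - 1#              ≈⟨ +-assoc _ _ _ ⟩
    1# + fromℕ R m + (- fromℕ R n - 1#)          ≈⟨ +-congˡ (⁻¹-anti-homo-∙ 1# _) ⟨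
    fromℕ R (suc m) - fromℕ R (suc n)            ∎

  fromℤ-+ : ∀ a b → fromℤ R (a ℤ.+ b) ≈ fromℤ R a + fromℤ R b
  fromℤ-+ (+ m)    (+ n)    = fromℕ-+ m n
  fromℤ-+ (+ m)    -[1+ n ] = fromℤ-⊖ m (suc n)
  fromℤ-+ -[1+ m ] (+ n)    = trans (fromℤ-⊖ n (suc m)) (+-comm _ _)
  fromℤ-+ -[1+ m ] -[1+ n ] = begin
    - fromℕ R (suc (suc (m ℕ.+ n)))        ≡⟨ ≡.cong (λ t → - fromℕ R (suc t)) (ℕ.+-suc m n) ⟨
    - fromℕ R (suc m ℕ.+ suc n)            ≈⟨ -‿cong (fromℕ-+ (suc m) (suc n)) ⟩
    - (fromℕ R (suc m) + fromℕ R (suc n))  ≈⟨ ⁻¹-∙-comm _ _ ⟨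
    - fromℕ R (suc m) + - fromℕ R (suc n)  ∎

  fromℤ-pos-* : ∀ m b → fromℤ R (+ m ℤ.* b) ≈ fromℕ R m * fromℤ R b
  fromℤ-pos-* m (+ n) = begin
    fromℤ R (+ m ℤ.* + n)   ≡⟨ ≡.cong (fromℤ R) (ℤ.pos-* m n) ⟨
    fromℕ R (m ℕ.* n)       ≈⟨ fromℕ-* m n ⟩
    fromℕ R m * fromℕ R n   ∎
  fromℤ-pos-* m -[1+ n ] = begin
    fromℤ R (+ m ℤ.* ℤ.- + suc n)     ≡⟨ ≡.cong (fromℤ R) (ℤ.neg-distribʳ-* (+ m) (+ suc n)) ⟨
    fromℤ R (ℤ.- (+ m ℤ.* + suc n))   ≈⟨ fromℤ-neg (+ m ℤ.* + suc n) ⟩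
    - fromℤ R (+ m ℤ.* + suc n)       ≈⟨ -‿cong (fromℤ-pos-* m (+ suc n)) ⟩
    - (fromℕ R m * fromℕ R (suc n))   ≈⟨ -‿distribʳ-* _ _ ⟩
    fromℕ R m * - fromℕ R (suc n)     ∎

  fromℤ-* : ∀ a b → fromℤ R (a ℤ.* b) ≈ fromℤ R a * fromℤ R b
  fromℤ-* (+ m)    b = fromℤ-pos-* m b
  fromℤ-* -[1+ m ] b = begin
    fromℤ R (ℤ.- + suc m ℤ.* b)       ≡⟨ ≡.cong (fromℤ R) (ℤ.neg-distribˡ-* (+ suc m) b) ⟨
    fromℤ R (ℤ.- (+ suc m ℤ.* b))     ≈⟨ fromℤ-neg (+ suc m ℤ.* b) ⟩
    - fromℤ R (+ suc m ℤ.* b)         ≈⟨ -‿cong (fromℤ-pos-* (suc m) b) ⟩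
    - (fromℕ R (suc m) * fromℤ R b)   ≈⟨ -‿distribˡ-* _ _ ⟩
    - fromℕ R (suc m) * fromℤ R b     ∎

  fromℤ-homomorphism : ℤ.+-*-rawRing -Raw-AlmostCommutative⟶ ACR.fromCommutativeRing R
  fromℤ-homomorphism = record
    { ⟦_⟧    = fromℤ R
    ; +-homo = fromℤ-+
    ; *-homo = fromℤ-*
    ; -‿homo = fromℤ-neg
    ; 0-homo = refl
    ; 1-homo = +-identityʳ 1#
    }

  -- Integer coefficients let the solver cancel terms, which it cannot do with undecidable coefficients from R.
  open import Algebra.Solver.Ring ℤ.+-*-rawRing (ACR.fromCommutativeRing R) fromℤ-homomorphism
    (λ a b → Maybe.map (λ a≡b → reflexive (≡.cong (fromℤ R) a≡b)) (dec⇒maybe (a ℤ.≟ b)))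

  -- Opaque, so that unification sees ∑ n f and not the Fin-indexed sum it unfolds to.
  opaque
    ∑ : ℕ → (ℕ → Carrier) → Carrier
    ∑ n f = sum {n} (λ r → f (toℕ r))

    ∑-zero : ∀ f → ∑ 0 f ≈ 0#
    ∑-zero f = refl

    ∑-suc : ∀ n f → ∑ (suc n) f ≈ f 0 + ∑ n (λ r → f (suc r))
    ∑-suc n f = refl

    ∑-cong< : ∀ n {f g} → (∀ r → r < n → f r ≈ g r) → ∑ n f ≈ ∑ n g
    ∑-cong< n f≈g = sum-cong-≋ (λ r → f≈g (toℕ r) (toℕ<n r))

    ∑-+ : ∀ n f g → ∑ n (λ r → f r + g r) ≈ ∑ n f + ∑ n g
    ∑-+ n f g = ∑-distrib-+ {n} (λ r → f (toℕ r)) (λ r → g (toℕ r))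

    ∑-*ˡ : ∀ n a f → a * ∑ n f ≈ ∑ n (λ r → a * f r)
    ∑-*ˡ n a f = *-distribˡ-sum {n} a (λ r → f (toℕ r))

    ∑-0# : ∀ n → ∑ n (λ _ → 0#) ≈ 0#
    ∑-0# n = sum-replicate-zero n

  ∑-one : ∀ f → ∑ 1 f ≈ f 0
  ∑-one f = trans (∑-suc 0 f) (trans (+-congˡ (∑-zero _)) (+-identityʳ _))

  ∑-linear : ∀ n f a g → ∑ n (λ r → f r + a * g r) ≈ ∑ n f + a * ∑ n g
  ∑-linear n f a g = trans (∑-+ n f (λ r → a * g r)) (+-congˡ (sym (∑-*ˡ n a g)))

  ∑-dropLast : ∀ n {f} → f n ≈ 0# → ∑ (suc n) f ≈ ∑ n f
  ∑-dropLast zero    {f} f0≈0 = begin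
    ∑ 1 f                         ≈⟨ ∑-suc 0 f ⟩
    f 0 + ∑ 0 (λ r → f (suc r))   ≈⟨ +-cong f0≈0 (∑-zero _) ⟩
    0# + 0#                       ≈⟨ +-identityˡ 0# ⟩
    0#                            ≈⟨ ∑-zero f ⟨
    ∑ 0 f                         ∎
  ∑-dropLast (suc n) {f} fn≈0 = begin
    ∑ (suc (suc n)) f                 ≈⟨ ∑-suc (suc n) f ⟩
    f 0 + ∑ (suc n) (λ r → f (suc r)) ≈⟨ +-congˡ (∑-dropLast n fn≈0) ⟩
    f 0 + ∑ n (λ r → f (suc r))       ≈⟨ ∑-suc n f ⟨
    ∑ (suc n) f                       ∎

  ∑-pascal : ∀ n (h : ℕ → Carrier) → ∑ (suc (suc n)) (λ r → fromℕ R (suc n C r) * h r)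
                   ≈ ∑ (suc n) (λ r → fromℕ R (n C r) * h (suc r)) + ∑ (suc n) (λ r → fromℕ R (n C r) * h r)
  ∑-pascal n h = begin
    ∑ (suc (suc n)) (λ r → fromℕ R (suc n C r) * h r)
      ≈⟨ ∑-suc (suc n) _ ⟩
    h₀ + ∑ (suc n) (λ r → fromℕ R (suc n C suc r) * h (suc r))
      ≈⟨ +-congˡ (∑-cong< (suc n) (λ r _ → pascal r)) ⟩
    h₀ + ∑ (suc n) (λ r → fromℕ R (n C r) * h (suc r) + fromℕ R (n C suc r) * h (suc r))
      ≈⟨ +-congˡ (∑-+ (suc n) _ _) ⟩
    h₀ + (∑ (suc n) (λ r → fromℕ R (n C r) * h (suc r)) + ∑ (suc n) (λ r → fromℕ R (n C suc r) * h (suc r)))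
      ≈⟨ x+[y+z]≈y+[x+z] _ _ _ ⟩
    ∑ (suc n) (λ r → fromℕ R (n C r) * h (suc r)) + (h₀ + ∑ (suc n) (λ r → fromℕ R (n C suc r) * h (suc r)))
      ≈⟨ +-congˡ (∑-suc (suc n) _) ⟨
    ∑ (suc n) (λ r → fromℕ R (n C r) * h (suc r)) + ∑ (suc (suc n)) (λ r → fromℕ R (n C r) * h r)
      ≈⟨ +-congˡ (∑-dropLast (suc n) last≈0) ⟩
    ∑ (suc n) (λ r → fromℕ R (n C r) * h (suc r)) + ∑ (suc n) (λ r → fromℕ R (n C r) * h r) ∎
    where
    h₀ = fromℕ R (n C 0) * h 0
    pascal : ∀ r → fromℕ R (suc n C suc r) * h (suc r)
                 ≈ fromℕ R (n C r) * h (suc r) + fromℕ R (n C suc r) * h (suc r)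
    pascal r = begin
      fromℕ R (suc n C suc r) * h (suc r)
        ≡⟨ ≡.cong (λ m → fromℕ R m * h (suc r)) (nCk+nC[k+1]≡[n+1]C[k+1] n r) ⟨
      fromℕ R (n C r ℕ.+ n C suc r) * h (suc r)
        ≈⟨ *-congʳ (fromℕ-+ (n C r) (n C suc r)) ⟩
      (fromℕ R (n C r) + fromℕ R (n C suc r)) * h (suc r)
        ≈⟨ distribʳ _ _ _ ⟩
      fromℕ R (n C r) * h (suc r) + fromℕ R (n C suc r) * h (suc r) ∎
    last≈0 : fromℕ R (n C suc n) * h (suc n) ≈ 0#
    last≈0 = begin
      fromℕ R (n C suc n) * h (suc n) ≡⟨ ≡.cong (λ m → fromℕ R m * h (suc n)) (k>n⇒nCk≡0 (ℕ.n<1+n n)) ⟩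
      0# * h (suc n)                  ≈⟨ zeroˡ _ ⟩
      0#                              ∎

  sumFrom-suc : ∀ a n f → sumFrom R (suc a) n f ≡ sumFrom R a n (λ r → f (suc r))
  sumFrom-suc a zero    f = ≡.refl
  sumFrom-suc a (suc n) f = ≡.cong (_+_ (f (suc a))) (sumFrom-suc (suc a) n f)

  sumFrom-0≈∑ : ∀ n f → sumFrom R 0 n f ≈ ∑ n f
  sumFrom-0≈∑ zero    f = sym (∑-zero f)
  sumFrom-0≈∑ (suc n) f = begin
    f 0 + sumFrom R 1 n f                   ≡⟨ ≡.cong (_+_ (f 0)) (sumFrom-suc 0 n f) ⟩
    f 0 + sumFrom R 0 n (λ r → f (suc r))   ≈⟨ +-congˡ (sumFrom-0≈∑ n _) ⟩
    f 0 + ∑ n (λ r → f (suc r))             ≈⟨ ∑-suc n f ⟨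
    ∑ (suc n) f                             ∎

  sumFrom-dropZeros : ∀ d m f → (∀ r → r < d → f r ≈ 0#) → sumFrom R 0 (d ℕ.+ m) f ≈ sumFrom R d m f
  sumFrom-dropZeros zero    m f _       = refl
  sumFrom-dropZeros (suc d) m f f<d≈0 = begin
    f 0 + sumFrom R 1 (d ℕ.+ m) f                   ≡⟨ ≡.cong (_+_ (f 0)) (sumFrom-suc 0 (d ℕ.+ m) f) ⟩
    f 0 + sumFrom R 0 (d ℕ.+ m) (λ r → f (suc r))
      ≈⟨ +-cong (f<d≈0 0 (s≤s ℕ.z≤n)) (sumFrom-dropZeros d m _ (λ r r<d → f<d≈0 (suc r) (s≤s r<d))) ⟩
    0# + sumFrom R d m (λ r → f (suc r))            ≈⟨ +-identityˡ _ ⟩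
    sumFrom R d m (λ r → f (suc r))                 ≡⟨ sumFrom-suc d m f ⟨
    sumFrom R (suc d) m f                           ∎

  sumRange≈∑ : ∀ j i {f} → (∀ r → r < j → f r ≈ 0#) → sumRange R j i f ≈ ∑ (suc i) f
  sumRange≈∑ j i {f} f<j≈0 with ℕ.≤-<-connex j (suc i)
  ... | inj₁ j≤1+i = begin
    sumFrom R j (suc i ∸ j) f              ≈⟨ sumFrom-dropZeros j (suc i ∸ j) f f<j≈0 ⟨
    sumFrom R 0 (j ℕ.+ (suc i ∸ j)) f      ≡⟨ ≡.cong (λ n → sumFrom R 0 n f) (ℕ.m+[n∸m]≡n j≤1+i) ⟩
    sumFrom R 0 (suc i) f                  ≈⟨ sumFrom-0≈∑ (suc i) f ⟩
    ∑ (suc i) f                            ∎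
  ... | inj₂ 1+i<j = begin
    sumFrom R j (suc i ∸ j) f
      ≡⟨ ≡.cong (λ n → sumFrom R j n f) (ℕ.m≤n⇒m∸n≡0 (ℕ.<⇒≤ 1+i<j)) ⟩
    0#
      ≈⟨ sumFrom-dropZeros (suc i) 0 f (λ r r<1+i → f<j≈0 r (ℕ.<-trans r<1+i 1+i<j)) ⟨
    sumFrom R 0 (suc i ℕ.+ 0) f
      ≡⟨ ≡.cong (λ n → sumFrom R 0 n f) (ℕ.+-identityʳ (suc i)) ⟩
    sumFrom R 0 (suc i) f
      ≈⟨ sumFrom-0≈∑ (suc i) f ⟩
    ∑ (suc i) f ∎

  timesX : (ℕ → Carrier) → ℕ → Carrier
  timesX p zero    = 0#
  timesX p (suc j) = p j

  timesX-cong : ∀ {p q} → (∀ j → p j ≈ q j) → ∀ j → timesX p j ≈ timesX q j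
  timesX-cong p≈q zero    = refl
  timesX-cong p≈q (suc j) = p≈q j

  timesX-*ˡ : ∀ a p j → a * timesX p j ≈ timesX (λ j′ → a * p j′) j
  timesX-*ˡ a p zero    = zeroʳ a
  timesX-*ˡ a p (suc j) = refl

  timesX-*ʳ : ∀ p a j → timesX p j * a ≈ timesX (λ j′ → p j′ * a) j
  timesX-*ʳ p a zero    = zeroˡ a
  timesX-*ʳ p a (suc j) = refl

  timesX-∑ : ∀ n (p : ℕ → ℕ → Carrier) j →
             timesX (λ j′ → ∑ n (λ r → p r j′)) j ≈ ∑ n (λ r → timesX (p r) j)
  timesX-∑ n p zero    = sym (∑-0# n)
  timesX-∑ n p (suc j) = refl

  unitCoeff : ℕ → Carrier
  unitCoeff zero    = 1#
  unitCoeff (suc j) = 0#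

  fallingCoeff : Carrier → ℕ → ℕ → Carrier
  fallingCoeff b zero    j = unitCoeff j
  fallingCoeff b (suc i) j = timesX (fallingCoeff b i) j + (- (b + fromℕ R i)) * fallingCoeff b i j

  fallingCoeff-vanishes : ∀ b {i j} → i < j → fallingCoeff b i j ≈ 0#
  fallingCoeff-vanishes b {zero}  {suc j} _         = refl
  fallingCoeff-vanishes b {suc i} {suc j} (s≤s i<j) = begin
    fallingCoeff b i j + (- (b + fromℕ R i)) * fallingCoeff b i (suc j)
      ≈⟨ +-cong (fallingCoeff-vanishes b i<j) (*-congˡ (fallingCoeff-vanishes b (ℕ.m<n⇒m<1+n i<j))) ⟩
    0# + (- (b + fromℕ R i)) * 0#
      ≈⟨ trans (+-identityˡ _) (zeroʳ _) ⟩
    0# ∎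

  fromℤ-coeff-shiftP : ∀ p j → fromℤ R (coeff (shiftP p) j) ≡ timesX (λ r → fromℤ R (coeff p r)) j
  fromℤ-coeff-shiftP p zero    = ≡.refl
  fromℤ-coeff-shiftP p (suc j) = ≡.refl

  fromℤ-coeff-mulLin : ∀ m p j →
    fromℤ R (coeff (mulLin m p) j) ≈ timesX (λ r → fromℤ R (coeff p r)) j + (- fromℕ R m) * fromℤ R (coeff p j)
  fromℤ-coeff-mulLin m p j = begin
    fromℤ R (coeff (mulLin m p) j)
      ≡⟨ ≡.cong (fromℤ R) (coeff-addP (shiftP p) (scaleP (ℤ.- + m) p) j) ⟩
    fromℤ R (coeff (shiftP p) j ℤ.+ coeff (scaleP (ℤ.- + m) p) j)
      ≡⟨ ≡.cong (λ x → fromℤ R (coeff (shiftP p) j ℤ.+ x)) (coeff-scaleP (ℤ.- + m) p j) ⟩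
    fromℤ R (coeff (shiftP p) j ℤ.+ ℤ.- + m ℤ.* coeff p j)
      ≈⟨ trans (fromℤ-+ (coeff (shiftP p) j) _) (+-congˡ (fromℤ-* (ℤ.- + m) (coeff p j))) ⟩
    fromℤ R (coeff (shiftP p) j) + fromℤ R (ℤ.- + m) * fromℤ R (coeff p j)
      ≈⟨ +-cong (reflexive (fromℤ-coeff-shiftP p j)) (*-congʳ (fromℤ-neg (+ m))) ⟩
    timesX (λ r → fromℤ R (coeff p r)) j + (- fromℕ R m) * fromℤ R (coeff p j) ∎

  fromℤ-s≈fallingCoeff : ∀ i j → fromℤ R (s i j) ≈ fallingCoeff 0# i j
  fromℤ-s≈fallingCoeff zero    zero    = +-identityʳ 1#
  fromℤ-s≈fallingCoeff zero    (suc j) = refl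
  fromℤ-s≈fallingCoeff (suc i) j       = begin
    fromℤ R (coeff (mulLin i (fallingPoly i)) j)
      ≈⟨ fromℤ-coeff-mulLin i (fallingPoly i) j ⟩
    timesX (λ r → fromℤ R (s i r)) j + (- fromℕ R i) * fromℤ R (s i j)
      ≈⟨ +-cong (timesX-cong (fromℤ-s≈fallingCoeff i) j)
                (*-cong (-‿cong (sym (+-identityˡ _))) (fromℤ-s≈fallingCoeff i j)) ⟩
    timesX (fallingCoeff 0# i) j + (- (0# + fromℕ R i)) * fallingCoeff 0# i j ∎

  fallingCoeff-vandermonde : ∀ {a b e} → a ≈ b + e → ∀ i j →
    fallingCoeff b i j ≈ ∑ (suc i) (λ r → fromℕ R (i C r) * (falling R e (i ∸ r) * fallingCoeff a r j))
  fallingCoeff-vandermonde {a} {b} {e} a≈b+e = vandermonde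
    where
    vandermonde : ∀ i j →
      fallingCoeff b i j ≈ ∑ (suc i) (λ r → fromℕ R (i C r) * (falling R e (i ∸ r) * fallingCoeff a r j))
    vandermonde zero    j = sym (begin
      ∑ 1 (λ r → fromℕ R (0 C r) * (falling R e (0 ∸ r) * fallingCoeff a r j)) ≈⟨ ∑-one _ ⟩
      (1# + 0#) * (1# * unitCoeff j)                                       ≈⟨ *-congʳ (+-identityʳ 1#) ⟩
      1# * (1# * unitCoeff j)                                              ≈⟨ trans (*-identityˡ _) (*-identityˡ _) ⟩
      unitCoeff j                                                          ∎)
    vandermonde (suc i) j = begin
      timesX (fallingCoeff b i) j + d * fallingCoeff b i j
        ≈⟨ +-cong (timesX-cong (vandermonde i) j) (*-congˡ (vandermonde i j)) ⟩
      timesX (λ j′ → ∑ (suc i) (λ r → S r j′)) j + d * ∑ (suc i) (λ r → S r j)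
        ≈⟨ +-congʳ (timesX-∑ (suc i) S j) ⟩
      ∑ (suc i) (λ r → timesX (S r) j) + d * ∑ (suc i) (λ r → S r j)
        ≈⟨ ∑-linear (suc i) _ d _ ⟨
      ∑ (suc i) (λ r → timesX (S r) j + d * S r j)
        ≈⟨ ∑-cong< (suc i) (λ r r<1+i → split r (ℕ.s≤s⁻¹ r<1+i)) ⟩
      ∑ (suc i) (λ r → fromℕ R (i C r) * h (suc r) + fromℕ R (i C r) * h r)
        ≈⟨ ∑-+ (suc i) _ _ ⟩
      ∑ (suc i) (λ r → fromℕ R (i C r) * h (suc r)) + ∑ (suc i) (λ r → fromℕ R (i C r) * h r)
        ≈⟨ ∑-pascal i h ⟨
      ∑ (suc (suc i)) (λ r → fromℕ R (suc i C r) * h r) ∎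
      where
      d = - (b + fromℕ R i)
      S : ℕ → ℕ → Carrier
      S r j′ = fromℕ R (i C r) * (falling R e (i ∸ r) * fallingCoeff a r j′)
      h : ℕ → Carrier
      h r = falling R e (suc i ∸ r) * fallingCoeff a r j
      -- b + i = (a + r) - (e - (i - r)) splits each term into the two halves of Pascal's rule.
      rearrange : ∀ C f X F b e ρ δ →
        C * (f * X) + (- (b + (ρ + δ))) * (C * (f * F))
          ≈ C * (f * (X + (- ((b + e) + ρ)) * F)) + C * ((f * (e - δ)) * F)
      rearrange = solve 8 (λ C f X F b e ρ δ →
        C :* (f :* X) :+ (:- (b :+ (ρ :+ δ))) :* (C :* (f :* F))
          := C :* (f :* (X :+ (:- ((b :+ e) :+ ρ)) :* F)) :+ C :* ((f :* (e :- δ)) :* F)) refl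
      split : ∀ r → r ≤ i → timesX (S r) j + d * S r j ≈ fromℕ R (i C r) * h (suc r) + fromℕ R (i C r) * h r
      split r r≤i = begin
        timesX (S r) j + d * S r j
          ≈⟨ +-cong (trans (sym (timesX-*ˡ w _ j)) (*-congˡ (sym (timesX-*ˡ f _ j))))
                    (*-congʳ (-‿cong (+-congˡ i≈r+[i∸r]))) ⟩
        w * (f * timesX (fallingCoeff a r) j) + (- (b + (fromℕ R r + fromℕ R (i ∸ r)))) * (w * (f * fallingCoeff a r j))
          ≈⟨ rearrange w f _ _ b e _ _ ⟩
        w * (f * (timesX (fallingCoeff a r) j + (- ((b + e) + fromℕ R r)) * fallingCoeff a r j))
          + w * ((f * (e - fromℕ R (i ∸ r))) * fallingCoeff a r j)
          ≈⟨ +-cong (*-congˡ (*-congˡ (+-congˡ (*-congʳ (-‿cong (+-congʳ (sym a≈b+e)))))))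
                    (*-congˡ (*-congʳ (reflexive (≡.cong (falling R e) (≡.sym (ℕ.+-∸-assoc 1 r≤i)))))) ⟩
        w * h (suc r) + w * h r ∎
        where
        w = fromℕ R (i C r)
        f = falling R e (i ∸ r)
        i≈r+[i∸r] : fromℕ R i ≈ fromℕ R r + fromℕ R (i ∸ r)
        i≈r+[i∸r] = trans (reflexive (≡.cong (fromℕ R) (≡.sym (ℕ.m+[n∸m]≡n r≤i)))) (fromℕ-+ r (i ∸ r))

  -- The coefficient of x^j in p(x - k) is Σ_r taylorWeight k j r * p_r.
  taylorWeight : Carrier → ℕ → ℕ → Carrier
  taylorWeight k j r = fromℕ R (r C j) * _^_ R (- k) (r ∸ j)

  taylorWeight-vanishes : ∀ k {j r} → r < j → taylorWeight k j r ≈ 0#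
  taylorWeight-vanishes k {j} {r} r<j = begin
    fromℕ R (r C j) * _^_ R (- k) (r ∸ j) ≡⟨ ≡.cong (λ m → fromℕ R m * _^_ R (- k) (r ∸ j)) (k>n⇒nCk≡0 r<j) ⟩
    0# * _^_ R (- k) (r ∸ j)              ≈⟨ zeroˡ _ ⟩
    0#                                    ∎

  taylorWeight-zero : ∀ k j → taylorWeight k j 0 ≈ unitCoeff j
  taylorWeight-zero k zero    = trans (*-identityʳ _) (+-identityʳ 1#)
  taylorWeight-zero k (suc j) = zeroˡ 1#

  taylorWeight-suc : ∀ k j r →
    taylorWeight k j (suc r) ≈ timesX (λ j′ → taylorWeight k j′ r) j + (- k) * taylorWeight k j r
  taylorWeight-suc k zero    r =
    solve 3 (λ u m p → u :* (m :* p) := con (+ 0) :+ m :* (u :* p)) refl (1# + 0#) (- k) _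
  taylorWeight-suc k (suc j) r = begin
    fromℕ R (suc r C suc j) * _^_ R (- k) (r ∸ j)
      ≡⟨ ≡.cong (λ m → fromℕ R m * _^_ R (- k) (r ∸ j)) (nCk+nC[k+1]≡[n+1]C[k+1] r j) ⟨
    fromℕ R (r C j ℕ.+ r C suc j) * _^_ R (- k) (r ∸ j)
      ≈⟨ trans (*-congʳ (fromℕ-+ (r C j) (r C suc j))) (distribʳ _ _ _) ⟩
    taylorWeight k j r + fromℕ R (r C suc j) * _^_ R (- k) (r ∸ j)
      ≈⟨ +-congˡ (lowerPower (ℕ.<-≤-connex j r)) ⟩
    taylorWeight k j r + (- k) * taylorWeight k (suc j) r ∎
    where
    lowerPower : j < r ⊎ r ≤ j →
      fromℕ R (r C suc j) * _^_ R (- k) (r ∸ j) ≈ (- k) * (fromℕ R (r C suc j) * _^_ R (- k) (r ∸ suc j))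
    lowerPower (inj₁ j<r) = begin
      fromℕ R (r C suc j) * _^_ R (- k) (r ∸ j)
        ≡⟨ ≡.cong (λ m → fromℕ R (r C suc j) * _^_ R (- k) m) (ℕ.+-∸-assoc 1 j<r) ⟩
      fromℕ R (r C suc j) * ((- k) * _^_ R (- k) (r ∸ suc j))
        ≈⟨ x*[y*z]≈y*[x*z] _ _ _ ⟩
      (- k) * (fromℕ R (r C suc j) * _^_ R (- k) (r ∸ suc j)) ∎
    lowerPower (inj₂ r≤j) rewrite k>n⇒nCk≡0 (s≤s r≤j) =
      trans (zeroˡ _) (sym (trans (*-congˡ (zeroˡ _)) (zeroʳ _)))

  ∑-taylor-timesX : ∀ k n p j →
    ∑ (suc n) (λ r → taylorWeight k j r * timesX p r)
      ≈ timesX (λ j′ → ∑ n (λ r → taylorWeight k j′ r * p r)) j + (- k) * ∑ n (λ r → taylorWeight k j r * p r)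
  ∑-taylor-timesX k n p j = begin
    ∑ (suc n) (λ r → taylorWeight k j r * timesX p r)
      ≈⟨ ∑-suc n _ ⟩
    taylorWeight k j 0 * 0# + ∑ n (λ r → taylorWeight k j (suc r) * p r)
      ≈⟨ trans (+-congʳ (zeroʳ _)) (+-identityˡ _) ⟩
    ∑ n (λ r → taylorWeight k j (suc r) * p r)
      ≈⟨ ∑-cong< n (λ r _ → distribute r) ⟩
    ∑ n (λ r → timesX (λ j′ → taylorWeight k j′ r * p r) j + (- k) * (taylorWeight k j r * p r))
      ≈⟨ ∑-linear n _ (- k) _ ⟩
    ∑ n (λ r → timesX (λ j′ → taylorWeight k j′ r * p r) j) + (- k) * ∑ n (λ r → taylorWeight k j r * p r)
      ≈⟨ +-congʳ (timesX-∑ n (λ r j′ → taylorWeight k j′ r * p r) j) ⟨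
    timesX (λ j′ → ∑ n (λ r → taylorWeight k j′ r * p r)) j + (- k) * ∑ n (λ r → taylorWeight k j r * p r) ∎
    where
    distribute : ∀ r → taylorWeight k j (suc r) * p r
      ≈ timesX (λ j′ → taylorWeight k j′ r * p r) j + (- k) * (taylorWeight k j r * p r)
    distribute r = begin
      taylorWeight k j (suc r) * p r
        ≈⟨ trans (*-congʳ (taylorWeight-suc k j r)) (distribʳ _ _ _) ⟩
      timesX (λ j′ → taylorWeight k j′ r) j * p r + (- k) * taylorWeight k j r * p r
        ≈⟨ +-cong (timesX-*ʳ _ (p r) j) (*-assoc _ _ _) ⟩
      timesX (λ j′ → taylorWeight k j′ r * p r) j + (- k) * (taylorWeight k j r * p r) ∎

  ∑-taylor-fallingCoeff : ∀ {a b k} → a ≈ b + k → ∀ i j →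
    ∑ (suc i) (λ r → taylorWeight k j r * fallingCoeff b i r) ≈ fallingCoeff a i j
  ∑-taylor-fallingCoeff {a} {b} {k} a≈b+k = taylor
    where
    taylor : ∀ i j → ∑ (suc i) (λ r → taylorWeight k j r * fallingCoeff b i r) ≈ fallingCoeff a i j
    taylor zero    j = trans (∑-one _) (trans (*-identityʳ _) (taylorWeight-zero k j))
    taylor (suc i) j = begin
      ∑ (suc (suc i)) (λ r → taylorWeight k j r * (timesX (fallingCoeff b i) r + d * fallingCoeff b i r))
        ≈⟨ ∑-cong< (suc (suc i)) (λ r _ → distribute _ _ _ _) ⟩
      ∑ (suc (suc i)) (λ r → taylorWeight k j r * timesX (fallingCoeff b i) r + d * (taylorWeight k j r * fallingCoeff b i r))
        ≈⟨ ∑-linear (suc (suc i)) _ d _ ⟩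
      ∑ (suc (suc i)) (λ r → taylorWeight k j r * timesX (fallingCoeff b i) r)
        + d * ∑ (suc (suc i)) (λ r → taylorWeight k j r * fallingCoeff b i r)
        ≈⟨ +-cong (∑-taylor-timesX k (suc i) (fallingCoeff b i) j) (*-congˡ (∑-dropLast (suc i) lastVanishes)) ⟩
      (timesX (λ j′ → ∑ (suc i) (λ r → taylorWeight k j′ r * fallingCoeff b i r)) j
        + (- k) * ∑ (suc i) (λ r → taylorWeight k j r * fallingCoeff b i r))
        + d * ∑ (suc i) (λ r → taylorWeight k j r * fallingCoeff b i r)
        ≈⟨ +-cong (+-cong (timesX-cong (taylor i) j) (*-congˡ (taylor i j))) (*-congˡ (taylor i j)) ⟩
      (timesX (fallingCoeff a i) j + (- k) * fallingCoeff a i j) + d * fallingCoeff a i j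
        ≈⟨ collect _ _ b k (fromℕ R i) ⟩
      timesX (fallingCoeff a i) j + (- ((b + k) + fromℕ R i)) * fallingCoeff a i j
        ≈⟨ +-congˡ (*-congʳ (-‿cong (+-congʳ (sym a≈b+k)))) ⟩
      fallingCoeff a (suc i) j ∎
      where
      d = - (b + fromℕ R i)
      distribute : ∀ w X d F → w * (X + d * F) ≈ w * X + d * (w * F)
      distribute = solve 4 (λ w X d F → w :* (X :+ d :* F) := w :* X :+ d :* (w :* F)) refl
      collect : ∀ X F b k ι → (X + (- k) * F) + (- (b + ι)) * F ≈ X + (- ((b + k) + ι)) * F
      collect = solve 5 (λ X F b k ι → (X :+ (:- k) :* F) :+ (:- (b :+ ι)) :* F := X :+ (:- ((b :+ k) :+ ι)) :* F) refl
      lastVanishes : taylorWeight k j (suc i) * fallingCoeff b i (suc i) ≈ 0#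
      lastVanishes = trans (*-congˡ (fallingCoeff-vanishes b (ℕ.n<1+n i))) (zeroʳ _)

  cc≈fallingCoeff : ∀ i j k → cc R i j k ≈ fallingCoeff k i j
  cc≈fallingCoeff i j k = begin
    cc R i j k
      ≈⟨ sumRange≈∑ j i (λ r r<j → trans (*-congʳ (taylorWeight-vanishes k r<j)) (zeroˡ _)) ⟩
    ∑ (suc i) (λ r → taylorWeight k j r * fromℤ R (s i r))
      ≈⟨ ∑-cong< (suc i) (λ r _ → *-congˡ (fromℤ-s≈fallingCoeff i r)) ⟩
    ∑ (suc i) (λ r → taylorWeight k j r * fallingCoeff 0# i r)
      ≈⟨ ∑-taylor-fallingCoeff (sym (+-identityˡ k)) i j ⟩
    fallingCoeff k i j ∎

  sumRange-cc≈∑-fallingCoeff : ∀ i j k (u : ℕ → Carrier) →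
    sumRange R j i (λ r → u r * cc R r j k) ≈ ∑ (suc i) (λ r → u r * fallingCoeff k r j)
  sumRange-cc≈∑-fallingCoeff i j k u = begin
    sumRange R j i (λ r → u r * cc R r j k)
      ≈⟨ sumRange≈∑ j i (λ r r<j →
           trans (*-congˡ (trans (cc≈fallingCoeff r j k) (fallingCoeff-vanishes k r<j))) (zeroʳ _)) ⟩
    ∑ (suc i) (λ r → u r * cc R r j k)
      ≈⟨ ∑-cong< (suc i) (λ r _ → *-congˡ (cc≈fallingCoeff r j k)) ⟩
    ∑ (suc i) (λ r → u r * fallingCoeff k r j) ∎

  falling-[-1] : ∀ m → falling R (- 1#) m ≈ _^_ R (- 1#) m * fromℕ R (m !)
  falling-[-1] zero    = sym (trans (*-identityˡ _) (+-identityʳ 1#))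
  falling-[-1] (suc m) = begin
    falling R (- 1#) m * (- 1# - fromℕ R m)
      ≈⟨ *-cong (falling-[-1] m) (⁻¹-∙-comm 1# (fromℕ R m)) ⟩
    _^_ R (- 1#) m * fromℕ R (m !) * - fromℕ R (suc m)
      ≈⟨ solve 3 (λ p f N → p :* f :* (:- N) := (:- p) :* (N :* f)) refl _ _ _ ⟩
    - _^_ R (- 1#) m * (fromℕ R (suc m) * fromℕ R (m !))
      ≈⟨ *-cong (sym (-1*x≈-x _)) (sym (fromℕ-* (suc m) (m !))) ⟩
    _^_ R (- 1#) (suc m) * fromℕ R (suc m !) ∎

  iP[i∸r]*[-1]^[i∸r]≈iCr*falling[-1] : ∀ {i r} → r ≤ i →
    fromℕ R (i P (i ∸ r)) * _^_ R (- 1#) (i ∸ r) ≈ fromℕ R (i C r) * falling R (- 1#) (i ∸ r)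
  iP[i∸r]*[-1]^[i∸r]≈iCr*falling[-1] {i} {r} r≤i = begin
    fromℕ R (i P (i ∸ r)) * _^_ R (- 1#) (i ∸ r)
      ≡⟨ ≡.cong (λ n → fromℕ R n * _^_ R (- 1#) (i ∸ r)) (nPk≡nCk*k! (ℕ.m∸n≤m i r)) ⟩
    fromℕ R ((i C (i ∸ r)) ℕ.* (i ∸ r) !) * _^_ R (- 1#) (i ∸ r)
      ≡⟨ ≡.cong (λ n → fromℕ R (n ℕ.* (i ∸ r) !) * _^_ R (- 1#) (i ∸ r)) (nCk≡nC[n∸k] r≤i) ⟨
    fromℕ R ((i C r) ℕ.* (i ∸ r) !) * _^_ R (- 1#) (i ∸ r)
      ≈⟨ *-congʳ (fromℕ-* (i C r) _) ⟩
    fromℕ R (i C r) * fromℕ R ((i ∸ r) !) * _^_ R (- 1#) (i ∸ r)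
      ≈⟨ trans (*-assoc _ _ _) (*-congˡ (*-comm _ _)) ⟩
    fromℕ R (i C r) * (_^_ R (- 1#) (i ∸ r) * fromℕ R ((i ∸ r) !))
      ≈⟨ *-congˡ (falling-[-1] (i ∸ r)) ⟨
    fromℕ R (i C r) * falling R (- 1#) (i ∸ r) ∎

corollary2p12 : {c ℓ : Level} (R : CommutativeRing c ℓ) (i j : ℕ) (k : CommutativeRing.Carrier R) →
    let open CommutativeRing R in
    (sumRange R j i (λ r → fromℕ R (i C r) * falling R k (i ∸ r) * cc R r j k) ≈ fromℤ R (s i j))
    × (sumRange R j i (λ r → fromℕ R (i P (i ∸ r)) * _^_ R (- 1#) (i ∸ r) * cc R r j k)
        ≈ cc R i j (k + 1#))
corollary2p12 R i j k = stirlingExpansion , shiftedExpansion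
  where
  open CommutativeRing R
  open FallingFactorialCoefficients R
  open import Algebra.Properties.AbelianGroup +-abelianGroup using (//-rightDividesʳ)
  open import Relation.Binary.Reasoning.Setoid setoid
  stirlingExpansion = begin
    sumRange R j i (λ r → fromℕ R (i C r) * falling R k (i ∸ r) * cc R r j k)
      ≈⟨ sumRange-cc≈∑-fallingCoeff i j k _ ⟩
    ∑ (suc i) (λ r → fromℕ R (i C r) * falling R k (i ∸ r) * fallingCoeff k r j)
      ≈⟨ ∑-cong< (suc i) (λ r _ → *-assoc _ _ _) ⟩
    ∑ (suc i) (λ r → fromℕ R (i C r) * (falling R k (i ∸ r) * fallingCoeff k r j))
      ≈⟨ fallingCoeff-vandermonde (sym (+-identityˡ k)) i j ⟨
    fallingCoeff 0# i j
      ≈⟨ fromℤ-s≈fallingCoeff i j ⟨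
    fromℤ R (s i j) ∎
  shiftedExpansion = begin
    sumRange R j i (λ r → fromℕ R (i P (i ∸ r)) * _^_ R (- 1#) (i ∸ r) * cc R r j k)
      ≈⟨ sumRange-cc≈∑-fallingCoeff i j k _ ⟩
    ∑ (suc i) (λ r → fromℕ R (i P (i ∸ r)) * _^_ R (- 1#) (i ∸ r) * fallingCoeff k r j)
      ≈⟨ ∑-cong< (suc i) (λ r r<1+i →
           trans (*-congʳ (iP[i∸r]*[-1]^[i∸r]≈iCr*falling[-1] (ℕ.s≤s⁻¹ r<1+i))) (*-assoc _ _ _)) ⟩
    ∑ (suc i) (λ r → fromℕ R (i C r) * (falling R (- 1#) (i ∸ r) * fallingCoeff k r j))
      ≈⟨ fallingCoeff-vandermonde (sym (//-rightDividesʳ 1# k)) i j ⟨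
    fallingCoeff (k + 1#) i j
      ≈⟨ cc≈fallingCoeff i j (k + 1#) ⟨
    cc R i j (k + 1#) ∎
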